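{- Let $\mathbf A$ be a semi-Heyting algebra satisfying $(x\to y)\to(x\to y^*)^*\approx1$ and also: (a) $x\vee(x\to y)\approx x\vee((x\to y)\to1)$; (b) $x^*\vee(x\to y)\approx(x\vee y)\to y$; (c) for all $x,y\in A$, $x\vee y=1$ implies $x=1$ or $y=1$. Then the height of (the lattice reduct of) $\mathbf A$ is at most $2$.
   Context: A semi-Heyting algebra is an algebra $\langle A;\wedge,\vee,\to,0,1\rangle$ such that $\langle A;\wedge,\vee,0,1\rangle$ is a bounded lattice and the identities $x\wedge(x\to y)\approx x\wedge y$, $x\wedge(y\to z)\approx x\wedge((x\wedge y)\to(x\wedge z))$, $x\to x\approx1$ hold. Write $x^*:=x\to0$. The height of a bounded lattice is the supremum of the lengths of its chains, where a chain with $k$ elements has length $k-1$. -}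

module Defs where

open import Level using (Level; suc; _⊔_)
open import Data.Nat using (ℕ; _≤_) renaming (suc to sucℕ)
open import Data.List using (List; length)
open import Data.List.Relation.Unary.Linked using (Linked)
open import Data.Product using (_×_)
open import Relation.Nullary using (¬_)
open import Relation.Binary.PropositionalEquality using (_≡_)
open import Algebra.Core using (Op₂)
open import Algebra.Lattice.Structures using (IsLattice)

record SemiHeytingAlgebra (c : Level) : Set (suc c) where
  infixr 5 _⇒_
  infixr 6 _∨_
  infixr 7 _∧_
  field
    Carrier : Set c
    _∧_ _∨_ _⇒_ : Op₂ Carrier
    𝟘 𝟙 : Carrier
    isLattice : IsLattice _≡_ _∨_ _∧_
    ∧-zero : ∀ x → x ∧ 𝟘 ≡ 𝟘
    ∨-one  : ∀ x → x ∨ 𝟙 ≡ 𝟙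
    sh1 : ∀ x y → x ∧ (x ⇒ y) ≡ x ∧ y
    sh2 : ∀ x y z → x ∧ (y ⇒ z) ≡ x ∧ ((x ∧ y) ⇒ (x ∧ z))
    sh3 : ∀ x → x ⇒ x ≡ 𝟙

  _* : Carrier → Carrier
  x * = x ⇒ 𝟘

  _≤ₗ_ : Carrier → Carrier → Set c
  x ≤ₗ y = x ∧ y ≡ x

  _<ₗ_ : Carrier → Carrier → Set c
  x <ₗ y = x ≤ₗ y × ¬ (x ≡ y)

  -- A finite chain of length k, listed in strictly increasing order:
  -- a list x₀ <ₗ x₁ <ₗ … <ₗ xₖ (length k+1 as a list).
  IsChain : List Carrier → Set c
  IsChain = Linked _<ₗ_

  -- height ≤ n : every chain has length (= #elements − 1) at most n.
  -- (Every chain, finite or infinite, with more than n+1 elements contains a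
  -- finite subchain with n+2 elements, so it suffices to bound finite chains.)
  HeightAtMost : ℕ → Set c
  HeightAtMost n = ∀ (xs : List Carrier) → IsChain xs → length xs ≤ sucℕ n

{-# OPTIONS --safe #-}
-- A nonzero w satisfies w → 1 = 1: by (b) with y = 1 we get w* ∨ (w → 1) = 1, and
-- w* = 1 would force w = w ∧ w* = 0, so (c) leaves w → 1 = 1. Now let 0 < a < b. Then
-- a ≤ b → a, so b → a ≠ 0, and (a) gives b ∨ (b → a) = b ∨ ((b → a) → 1) = 1. By (c)
-- either b = 1 or b → a = 1; the latter means b ≤ a, which is impossible. So a chain
-- x₀ < x₁ < x₂ < x₃ cannot exist: x₁ ≠ 0 would force x₂ = 1.
module Submission where

open import Defs
open import Level using (Level)
open import Data.Sum using (_⊎_; inj₁; inj₂)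
open import Data.Product using (_,_)
open import Data.List using ([]; _∷_)
open import Data.List.Relation.Unary.Linked using (_∷_)
open import Data.Nat using (z≤n; s≤s)
open import Relation.Nullary using (contradiction)
open import Relation.Binary.PropositionalEquality
  using (_≡_; _≢_; refl; sym; trans; cong; subst; module ≡-Reasoning)
open import Algebra.Lattice.Structures using (IsLattice)
open import Algebra.Lattice.Bundles using (Lattice)
import Algebra.Lattice.Properties.Lattice as LatticeProperties

module SemiHeytingProperties {c : Level} (A : SemiHeytingAlgebra c) where
  open SemiHeytingAlgebra A
  open IsLattice isLattice using (∧-comm; ∧-absorbs-∨)

  lattice : Lattice c c
  lattice = record { isLattice = isLattice }

  open LatticeProperties lattice using (∧-idem)
  open ≡-Reasoning

  ∧-identityʳ : ∀ x → x ∧ 𝟙 ≡ x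
  ∧-identityʳ x = trans (cong (x ∧_) (sym (∨-one x))) (∧-absorbs-∨ x 𝟙)

  𝟘-least : ∀ x → 𝟘 ≤ₗ x
  𝟘-least x = trans (∧-comm 𝟘 x) (∧-zero x)

  𝟙-greatest : ∀ x → x ≤ₗ 𝟙
  𝟙-greatest = ∧-identityʳ

  ≤ₗ-antisym : ∀ {x y} → x ≤ₗ y → y ≤ₗ x → x ≡ y
  ≤ₗ-antisym {x} {y} x≤y y≤x = trans (sym x≤y) (trans (∧-comm x y) y≤x)

  <ₗ⇒≢𝟘 : ∀ {x y} → x <ₗ y → y ≢ 𝟘
  <ₗ⇒≢𝟘 {x} (x≤y , x≢y) refl = x≢y (≤ₗ-antisym x≤y (𝟘-least x))

  <ₗ⇒≢𝟙 : ∀ {x y} → x <ₗ y → x ≢ 𝟙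
  <ₗ⇒≢𝟙 {y = y} (x≤y , x≢y) refl = x≢y (≤ₗ-antisym x≤y (𝟙-greatest y))

  [x⇒y]≡𝟙⇒x≤y : ∀ {x y} → x ⇒ y ≡ 𝟙 → x ≤ₗ y
  [x⇒y]≡𝟙⇒x≤y {x} {y} x⇒y≡𝟙 = begin
    x ∧ y        ≡⟨ sh1 x y ⟨
    x ∧ (x ⇒ y)  ≡⟨ cong (x ∧_) x⇒y≡𝟙 ⟩
    x ∧ 𝟙        ≡⟨ ∧-identityʳ x ⟩
    x            ∎

  x*≡𝟙⇒x≡𝟘 : ∀ {x} → x * ≡ 𝟙 → x ≡ 𝟘
  x*≡𝟙⇒x≡𝟘 {x} x*≡𝟙 = trans (sym ([x⇒y]≡𝟙⇒x≤y x*≡𝟙)) (∧-zero x)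

  x≤y⇒x≤[y⇒x] : ∀ {x y} → x ≤ₗ y → x ≤ₗ (y ⇒ x)
  x≤y⇒x≤[y⇒x] {x} {y} x≤y = begin
    x ∧ (y ⇒ x)              ≡⟨ sh2 x y x ⟩
    x ∧ ((x ∧ y) ⇒ (x ∧ x))  ≡⟨ cong (λ u → x ∧ (u ⇒ (x ∧ x))) x≤y ⟩
    x ∧ (x ⇒ (x ∧ x))        ≡⟨ cong (λ u → x ∧ (x ⇒ u)) (∧-idem x) ⟩
    x ∧ (x ⇒ x)              ≡⟨ cong (x ∧_) (sh3 x) ⟩
    x ∧ 𝟙                    ≡⟨ ∧-identityʳ x ⟩
    x                        ∎

  module _ (identity-a : ∀ x y → x ∨ (x ⇒ y) ≡ x ∨ ((x ⇒ y) ⇒ 𝟙))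
           (identity-b : ∀ x y → (x *) ∨ (x ⇒ y) ≡ (x ∨ y) ⇒ y)
           (∨-irreducible-𝟙 : ∀ x y → x ∨ y ≡ 𝟙 → (x ≡ 𝟙) ⊎ (y ≡ 𝟙)) where

    x≢𝟘⇒[x⇒𝟙]≡𝟙 : ∀ {x} → x ≢ 𝟘 → x ⇒ 𝟙 ≡ 𝟙
    x≢𝟘⇒[x⇒𝟙]≡𝟙 {x} x≢𝟘 with ∨-irreducible-𝟙 (x *) (x ⇒ 𝟙) x*∨[x⇒𝟙]≡𝟙
      where
      x*∨[x⇒𝟙]≡𝟙 : x * ∨ (x ⇒ 𝟙) ≡ 𝟙
      x*∨[x⇒𝟙]≡𝟙 = begin
        x * ∨ (x ⇒ 𝟙)  ≡⟨ identity-b x 𝟙 ⟩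
        (x ∨ 𝟙) ⇒ 𝟙    ≡⟨ cong (_⇒ 𝟙) (∨-one x) ⟩
        𝟙 ⇒ 𝟙          ≡⟨ sh3 𝟙 ⟩
        𝟙              ∎
    ... | inj₁ x*≡𝟙   = contradiction (x*≡𝟙⇒x≡𝟘 x*≡𝟙) x≢𝟘
    ... | inj₂ x⇒𝟙≡𝟙 = x⇒𝟙≡𝟙

    𝟘<x<y⇒y≡𝟙 : ∀ {x y} → x ≢ 𝟘 → x <ₗ y → y ≡ 𝟙
    𝟘<x<y⇒y≡𝟙 {x} {y} x≢𝟘 (x≤y , x≢y) with ∨-irreducible-𝟙 y (y ⇒ x) y∨[y⇒x]≡𝟙
      where
      y⇒x≢𝟘 : y ⇒ x ≢ 𝟘
      y⇒x≢𝟘 y⇒x≡𝟘 = x≢𝟘 (≤ₗ-antisym (subst (x ≤ₗ_) y⇒x≡𝟘 (x≤y⇒x≤[y⇒x] x≤y)) (𝟘-least x))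

      y∨[y⇒x]≡𝟙 : y ∨ (y ⇒ x) ≡ 𝟙
      y∨[y⇒x]≡𝟙 = begin
        y ∨ (y ⇒ x)          ≡⟨ identity-a y x ⟩
        y ∨ ((y ⇒ x) ⇒ 𝟙)    ≡⟨ cong (y ∨_) (x≢𝟘⇒[x⇒𝟙]≡𝟙 y⇒x≢𝟘) ⟩
        y ∨ 𝟙                ≡⟨ ∨-one y ⟩
        𝟙                    ∎
    ... | inj₁ y≡𝟙   = y≡𝟙
    ... | inj₂ y⇒x≡𝟙 = contradiction (≤ₗ-antisym x≤y ([x⇒y]≡𝟙⇒x≤y y⇒x≡𝟙)) x≢y

    heightAtMost2 : HeightAtMost 2
    heightAtMost2 []                    _ = z≤n
    heightAtMost2 (_ ∷ [])              _ = s≤s z≤n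
    heightAtMost2 (_ ∷ _ ∷ [])          _ = s≤s (s≤s z≤n)
    heightAtMost2 (_ ∷ _ ∷ _ ∷ [])      _ = s≤s (s≤s (s≤s z≤n))
    heightAtMost2 (_ ∷ _ ∷ _ ∷ _ ∷ _) (x₀<x₁ ∷ x₁<x₂ ∷ x₂<x₃ ∷ _) =
      contradiction (𝟘<x<y⇒y≡𝟙 (<ₗ⇒≢𝟘 x₀<x₁) x₁<x₂) (<ₗ⇒≢𝟙 x₂<x₃)

lemma6p3 : ∀ {c : Level} (A : SemiHeytingAlgebra c) → let open SemiHeytingAlgebra A in
    (∀ x y → (x ⇒ y) ⇒ ((x ⇒ (y *)) *) ≡ 𝟙) →
    (∀ x y → x ∨ (x ⇒ y) ≡ x ∨ ((x ⇒ y) ⇒ 𝟙)) →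
    (∀ x y → (x *) ∨ (x ⇒ y) ≡ (x ∨ y) ⇒ y) →
    (∀ x y → x ∨ y ≡ 𝟙 → (x ≡ 𝟙) ⊎ (y ≡ 𝟙)) →
    HeightAtMost 2
lemma6p3 A _ identity-a identity-b ∨-irreducible-𝟙 =
  SemiHeytingProperties.heightAtMost2 A identity-a identity-b ∨-irreducible-𝟙
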